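{- Let $I\subseteq[n]$, $\overline J\subseteq[\overline n]$ be a valid pair. Then the graph $G(I,\overline J)$ is connected.
   Context: Fix $n\ge1$, $[n]=\{1,\dots,n\}$, $[\overline n]=\{\overline1,\dots,\overline n\}$, totally ordered by $1\prec\overline1\prec2\prec\overline2\prec\cdots\prec n\prec\overline n$. A pair $I\subseteq[n]$, $\overline J\subseteq[\overline n]$ is valid if $\min(I\sqcup\overline J)\in I$ and $\max(I\sqcup\overline J)\in\overline J$ (w.r.t. $\prec$). Define $\mathrm{prec}:\overline J\to[n]$: if in $\prec$ restricted to $I\sqcup\overline J$ the element $\overline j$ is immediately preceded by some $i\in I$, then $\mathrm{prec}(\overline j)=i$; otherwise $\mathrm{prec}(\overline j)=j$. Let $\mathrm{prec}(A(I,\overline J))$ be the simple directed graph on vertex set $I\cup\mathrm{prec}(\overline J)\subseteq[n]$ with edges $(i,\mathrm{prec}(\overline j))$ for all $i\in I$, $\overline j\in\overline J$ with $i<\mathrm{prec}(\overline j)$. For a simple directed graph $H$ on a subset of $[n]$ with edges directed from smaller to larger vertex, $\min(H)$ is obtained by deleting each edge $(i,j)$ for which $H$ contains a directed path $i,i_1,\dots,i_k,j$ with $k\ge1$. Define $G(I,\overline J)=\min(\mathrm{prec}(A(I,\overline J)))$, with vertex set $I\cup\mathrm{prec}(\overline J)$. -}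

module Defs where

open import Data.Nat using (ℕ; zero; suc; _<_; _≤_; _<?_)
open import Data.Bool using (Bool; true; false; if_then_else_)
open import Data.Fin using (fromℕ<)
open import Data.Fin.Subset using (Subset)
open import Data.Vec using (lookup)
open import Data.Sum using (_⊎_)
open import Data.Product using (Σ; _×_; ∃)
open import Relation.Nullary using (¬_; yes; no)
open import Relation.Binary.PropositionalEquality using (_≡_)

-- Conventions: the element k ∈ [n] (1-based) is encoded by the natural number
-- k-1 (0-based); I ⊆ [n] and J ⊆ [n] (J the index set of the barred set J̄)
-- are Subsets of Fin n.  The order ≺ is encoded by the key
-- key(k) = 2k, key(k̄) = 2k+1.

_∈ᵇ_ : ℕ → {n : ℕ} → Subset n → Bool
_∈ᵇ_ k {n} S with k <? n
... | yes p = lookup S (fromℕ< p)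
... | no _  = false

-- Valid pair: min of I ⊔ J̄ (w.r.t. ≺) lies in I, max lies in J̄.
-- min i ∈ I: 2i ≤ 2k for k ∈ I and 2i ≤ 2k+1 (i.e. i ≤ k) for k̄ ∈ J̄.
-- max j̄ ∈ J̄: 2k ≤ 2j+1 (i.e. k ≤ j) for k ∈ I and 2k+1 ≤ 2j+1 for k̄ ∈ J̄.
Valid : {n : ℕ} → Subset n → Subset n → Set
Valid I J =
  (∃ λ i → ((i ∈ᵇ I) ≡ true) ×
     (∀ k → ((k ∈ᵇ I) ≡ true → i ≤ k) × ((k ∈ᵇ J) ≡ true → i ≤ k)))
  × (∃ λ j → ((j ∈ᵇ J) ≡ true) ×
     (∀ k → ((k ∈ᵇ I) ≡ true → k ≤ j) × ((k ∈ᵇ J) ≡ true → k ≤ j)))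

-- Scan downward from index m (examining element m-1, then m-2, ...) for the
-- element of I ⊔ J̄ immediately preceding j̄ (given that j ∉ I).
-- Elements below key 2j in decreasing ≺-order: (k̄, k), (k-1 bar, k-1), ...
precSearch : {n : ℕ} → Subset n → Subset n → ℕ → ℕ → ℕ
precSearch I J j zero = j
precSearch I J j (suc k) =
  if (k ∈ᵇ J) then j else (if (k ∈ᵇ I) then k else precSearch I J j k)

-- prec(j̄): if j ∈ I then j immediately precedes j̄, so prec = j;
-- otherwise look at the preceding element.
prec : {n : ℕ} → Subset n → Subset n → ℕ → ℕ
prec I J j = if (j ∈ᵇ I) then j else precSearch I J j j

Vertex : {n : ℕ} → Subset n → Subset n → ℕ → Set
Vertex I J v = ((v ∈ᵇ I) ≡ true) ⊎ (∃ λ j → ((j ∈ᵇ J) ≡ true) × (prec I J j ≡ v))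

PrecEdge : {n : ℕ} → Subset n → Subset n → ℕ → ℕ → Set
PrecEdge I J a b = ((a ∈ᵇ I) ≡ true) ×
  (∃ λ j → ((j ∈ᵇ J) ≡ true) × (prec I J j ≡ b)) × (a < b)

data Path (E : ℕ → ℕ → Set) : ℕ → ℕ → Set where
  edge : ∀ {a b} → E a b → Path E a b
  _∷_  : ∀ {a b c} → E a b → Path E b c → Path E a c

MinEdge : (ℕ → ℕ → Set) → ℕ → ℕ → Set
MinEdge E a b = E a b × ¬ (∃ λ c → E a c × Path E c b)

GEdge : {n : ℕ} → Subset n → Subset n → ℕ → ℕ → Set
GEdge I J = MinEdge (PrecEdge I J)

data UWalk (E : ℕ → ℕ → Set) : ℕ → ℕ → Set where
  here : ∀ {a} → UWalk E a a
  fwd  : ∀ {a b c} → E a b → UWalk E b c → UWalk E a c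
  bwd  : ∀ {a b c} → E b a → UWalk E b c → UWalk E a c

Connected : (ℕ → Set) → (ℕ → ℕ → Set) → Set
Connected V E = ∀ u v → V u → V v → UWalk E u v

-- Every edge of prec(A(I,J̄)) goes from an element of I up to a value of prec,
-- and prec(j̄) ≥ i for every i ∈ I with i ≤ j. So the minimum i₀ ∈ I is joined
-- to every prec(j̄), and every element of I is joined to prec(j̄₀) for the
-- maximum j̄₀: prec(A(I,J̄)) is connected. Passing to min(·) keeps every edge
-- connected through edges of smaller span, since an edge (a,b) is deleted only
-- in favour of a path a → c ⇝ b with a < c < b.

module Submission where

open import Defs
open import Data.Nat using (ℕ; zero; suc; _<_; _≤_; _<?_; _+_)
open import Data.Nat.Properties
  using (_≟_; ≤-trans; ≤-pred; ≤-reflexive; <⇒≤; <-≤-trans; ≤∧≢⇒<;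
         n≮n; <-trans; m≤n⇒m<n∨m≡n; +-suc; +-monoʳ-≤; m≤m+n; anyUpTo?)
import Data.Bool as Bool
open import Data.Bool using (true; false)
open import Data.Fin.Subset using (Subset)
open import Data.Product using (∃; _×_; _,_; proj₁; proj₂)
open import Data.Sum using (inj₁; inj₂)
open import Relation.Nullary using (Dec; yes; no; contradiction)
open import Relation.Nullary.Decidable using (_×-dec_; map′)
open import Relation.Unary using (Decidable)
open import Relation.Binary.PropositionalEquality using (_≡_; _≢_; refl; sym; trans)

module _ {E : ℕ → ℕ → Set} where

  infixr 5 _++ᵂ_

  _++ᵂ_ : ∀ {a b c} → UWalk E a b → UWalk E b c → UWalk E a c
  here      ++ᵂ q = q
  fwd e p   ++ᵂ q = fwd e (p ++ᵂ q)
  bwd e p   ++ᵂ q = bwd e (p ++ᵂ q)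

  reverseᵂ : ∀ {a b} → UWalk E a b → UWalk E b a
  reverseᵂ here      = here
  reverseᵂ (fwd e p) = reverseᵂ p ++ᵂ bwd e here
  reverseᵂ (bwd e p) = reverseᵂ p ++ᵂ fwd e here

  hub⇒connected : ∀ {V : ℕ → Set} h → (∀ w → V w → UWalk E w h) → Connected V E
  hub⇒connected h toHub u v Vu Vv = toHub u Vu ++ᵂ reverseᵂ (toHub v Vv)

module _ {E F : ℕ → ℕ → Set} (edge⇒walk : ∀ {a b} → E a b → UWalk F a b) where

  bindᵂ : ∀ {a b} → UWalk E a b → UWalk F a b
  bindᵂ here      = here
  bindᵂ (fwd e p) = edge⇒walk e ++ᵂ bindᵂ p
  bindᵂ (bwd e p) = reverseᵂ (edge⇒walk e) ++ᵂ bindᵂ p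

  connected-mono : ∀ {V : ℕ → Set} → Connected V E → Connected V F
  connected-mono conn u v Vu Vv = bindᵂ (conn u v Vu Vv)

module TransitiveReduction
  (E : ℕ → ℕ → Set)
  (increasing : ∀ {a b} → E a b → a < b)
  (bypass? : ∀ a b → Dec (∃ λ c → E a c × Path E c b))
  where

  path-increasing : ∀ {a b} → Path E a b → a < b
  path-increasing (edge e) = increasing e
  path-increasing (e ∷ p)  = <-≤-trans (increasing e) (<⇒≤ (path-increasing p))

  -- d bounds the span b − a; a bypass a → c ⇝ b only uses edges of smaller span.
  private
    reduceEdge : ∀ d {a b} → E a b → b ≤ d + a → UWalk (MinEdge E) a b
    reducePath : ∀ d {a b} → Path E a b → b ≤ d + a → UWalk (MinEdge E) a b

    reduceEdge zero {a} e b≤a = contradiction (<-≤-trans (increasing e) b≤a) (n≮n a)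
    reduceEdge (suc d) {a} {b} e b≤1+d+a with bypass? a b
    ... | no noBypass = fwd (e , noBypass) here
    ... | yes (c , a→c , c⇝b) =
      reduceEdge d a→c (≤-pred (<-≤-trans (path-increasing c⇝b) b≤1+d+a))
      ++ᵂ reducePath d c⇝b
            (≤-trans b≤1+d+a
              (≤-trans (≤-reflexive (sym (+-suc d a))) (+-monoʳ-≤ d (increasing a→c))))

    reducePath d (edge e) b≤d+a = reduceEdge d e b≤d+a
    reducePath d (e ∷ p) b≤d+a =
      reduceEdge d e (≤-trans (<⇒≤ (path-increasing p)) b≤d+a)
      ++ᵂ reducePath d p (≤-trans b≤d+a (+-monoʳ-≤ d (<⇒≤ (increasing e))))

  edge⇒minWalk : ∀ {a b} → E a b → UWalk (MinEdge E) a b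
  edge⇒minWalk {a} {b} e = reduceEdge b e (m≤m+n b a)

  min-connected : ∀ {V : ℕ → Set} → Connected V E → Connected V (MinEdge E)
  min-connected = connected-mono edge⇒minWalk

module UpEdges (S T : ℕ → Set) where

  UpEdge : ℕ → ℕ → Set
  UpEdge a b = S a × T b × a < b

  path⇒upEdge : ∀ {a b} → Path UpEdge a b → UpEdge a b
  path⇒upEdge (edge e) = e
  path⇒upEdge ((Sa , _ , a<c) ∷ p) with path⇒upEdge p
  ... | _ , Tb , c<b = Sa , Tb , <-trans a<c c<b

  bypass? : Decidable S → Decidable T →
            ∀ a b → Dec (∃ λ c → UpEdge a c × Path UpEdge c b)
  bypass? S? T? a b =
    map′ toBypass fromBypass
      (S? a ×-dec T? b ×-dec anyUpTo? (λ c → a <? c ×-dec S? c ×-dec T? c) b)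
    where
    Witnessed : Set
    Witnessed = S a × T b × ∃ λ c → c < b × a < c × S c × T c

    toBypass : Witnessed → ∃ λ c → UpEdge a c × Path UpEdge c b
    toBypass (Sa , Tb , c , c<b , a<c , Sc , Tc) = c , (Sa , Tc , a<c) , edge (Sc , Tb , c<b)

    fromBypass : (∃ λ c → UpEdge a c × Path UpEdge c b) → Witnessed
    fromBypass (c , (Sa , Tc , a<c) , c⇝b) with path⇒upEdge c⇝b
    ... | Sc , Tb , c<b = Sa , Tb , c , c<b , a<c , Sc , Tc

  ≤⇒walk : ∀ {a b} → S a → T b → a ≤ b → UWalk UpEdge a b
  ≤⇒walk Sa Tb a≤b with m≤n⇒m<n∨m≡n a≤b
  ... | inj₁ a<b  = fwd (Sa , Tb , a<b) here
  ... | inj₂ refl = here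

  min-connected : Decidable S → Decidable T → ∀ {V : ℕ → Set} →
                  Connected V UpEdge → Connected V (MinEdge UpEdge)
  min-connected S? T? =
    TransitiveReduction.min-connected UpEdge (λ (_ , _ , a<b) → a<b) (bypass? S? T?)

∈ᵇ⇒< : ∀ {n} k (S : Subset n) → (k ∈ᵇ S) ≡ true → k < n
∈ᵇ⇒< {n} k S k∈S with k <? n
... | yes k<n = k<n
... | no _    = contradiction k∈S λ ()

∈ᵇ-∉ᵇ⇒≢ : ∀ {n a k} (S : Subset n) → (a ∈ᵇ S) ≡ true → (k ∈ᵇ S) ≡ false → a ≢ k
∈ᵇ-∉ᵇ⇒≢ _ a∈S k∉S refl = contradiction (trans (sym a∈S) k∉S) λ ()

module _ {n : ℕ} (I J : Subset n) where

  InI : ℕ → Set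
  InI a = (a ∈ᵇ I) ≡ true

  IsPrec : ℕ → Set
  IsPrec b = ∃ λ j → ((j ∈ᵇ J) ≡ true) × (prec I J j ≡ b)

  inI? : Decidable InI
  inI? a = (a ∈ᵇ I) Bool.≟ true

  isPrec? : Decidable IsPrec
  isPrec? b =
    map′ (λ (j , _ , j∈J , eq) → j , j∈J , eq)
         (λ (j , j∈J , eq) → j , ∈ᵇ⇒< j J j∈J , j∈J , eq)
         (anyUpTo? (λ j → ((j ∈ᵇ J) Bool.≟ true) ×-dec (prec I J j ≟ b)) n)

  precSearch-≥ : ∀ {a} j m → InI a → a < m → a ≤ j → a ≤ precSearch I J j m
  precSearch-≥ j (suc k) a∈I a<1+k a≤j with k ∈ᵇ J
  ... | true = a≤j
  ... | false with k ∈ᵇ I in k∈I?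
  ...   | true  = ≤-pred a<1+k
  ...   | false = precSearch-≥ j k a∈I (≤∧≢⇒< (≤-pred a<1+k) (∈ᵇ-∉ᵇ⇒≢ I a∈I k∈I?)) a≤j

  prec-≥ : ∀ {a} j → InI a → a ≤ j → a ≤ prec I J j
  prec-≥ j a∈I a≤j with j ∈ᵇ I in j∈I?
  ... | true  = a≤j
  ... | false = precSearch-≥ j j a∈I (≤∧≢⇒< a≤j (∈ᵇ-∉ᵇ⇒≢ I a∈I j∈I?)) a≤j

  open UpEdges InI IsPrec using (≤⇒walk)

  walkToPrec : ∀ {a j} → InI a → (j ∈ᵇ J) ≡ true → a ≤ j →
               UWalk (PrecEdge I J) a (prec I J j)
  walkToPrec {j = j} a∈I j∈J a≤j = ≤⇒walk a∈I (j , j∈J , refl) (prec-≥ j a∈I a≤j)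

  precGraph-connected : Valid I J → Connected (Vertex I J) (PrecEdge I J)
  precGraph-connected ((i₀ , i₀∈I , i₀-min) , (j₀ , j₀∈J , j₀-max)) =
    hub⇒connected i₀ toI₀
    where
    toI₀ : ∀ w → Vertex I J w → UWalk (PrecEdge I J) w i₀
    toI₀ a (inj₁ a∈I) =
      walkToPrec a∈I j₀∈J (proj₁ (j₀-max a) a∈I)
      ++ᵂ reverseᵂ (walkToPrec i₀∈I j₀∈J (proj₁ (j₀-max i₀) i₀∈I))
    toI₀ _ (inj₂ (j , j∈J , refl)) = reverseᵂ (walkToPrec i₀∈I j∈J (proj₂ (i₀-min j) j∈J))

lemma3p9 : (n : ℕ) (I J : Subset n) → Valid I J →
    Connected (Vertex I J) (GEdge I J)
lemma3p9 n I J valid =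
  UpEdges.min-connected (InI I J) (IsPrec I J) (inI? I J) (isPrec? I J)
    (precGraph-connected I J valid)
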